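{- Let $G=(V,E)$ be a directed graph with arc weights $c:E\to\mathbb{Z}$, let $G_{12}$ be the weighted bipartite graph defined below, and let $y$ be a maximum weight vertex $1$-packing in $G_{12}$. If $y(V_1\cup V_2)=0$, then $p_v:=y(v_1)$ is a potential function on $G$, i.e., $c_{uv}+p_u-p_v\ge0$ for every arc $uv\in E$.
   Context: $G_{12}=(V_1\cup V_2,E_{12},c_{12})$ has $V_1=\{v_1:v\in V\}$, $V_2=\{v_2:v\in V\}$, $E_{12}=\{u_2v_1:uv\in E\}\cup\{v_1v_2:v\in V\}$, $c_{12}(u_2v_1)=c_{uv}$ and $c_{12}(v_1v_2)=0$. A vertex $1$-packing is $y\in\mathbb{R}^{V_1\cup V_2}$ with $y_a+y_b\le c_{12}(ab)$ for every edge $ab\in E_{12}$; it is maximum weight if it maximizes $y(V_1\cup V_2)=\sum_{a}y_a$.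
   Formalization: The vertex 1-packing y, and every packing its maximality is compared against, take values in ℚ instead of ℝ. -}

module Defs where

open import Data.Nat using (ℕ; zero; suc)
open import Data.Fin using (Fin; zero; suc)
open import Data.Integer using (ℤ)
open import Data.Sum using (_⊎_; inj₁; inj₂)
open import Data.Rational using (ℚ; 0ℚ; _+_; _≤_; _/_)

-- A directed graph G = (V, E) with V = Fin n and m arcs indexed by Fin m;
-- arc e goes from tail e to head e (parallel arcs and loops allowed),
-- with integer weight c e.
record Digraph (n m : ℕ) : Set where
  field
    tail : Fin m → Fin n
    head : Fin m → Fin n

ℤ→ℚ : ℤ → ℚ
ℤ→ℚ z = z / 1

-- Vertices of G12: inj₁ v = v₁ ∈ V₁, inj₂ v = v₂ ∈ V₂.
V12 : ℕ → Set
V12 n = Fin n ⊎ Fin n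

data E12 (n m : ℕ) : Set where
  arcEdge   : Fin m → E12 n m   -- u₂v₁ for arc uv
  matchEdge : Fin n → E12 n m   -- v₁v₂ for v ∈ V

module _ {n m : ℕ} (G : Digraph n m) (c : Fin m → ℤ) where
  open Digraph G

  end₁ : E12 n m → V12 n
  end₁ (arcEdge e)   = inj₂ (tail e)
  end₁ (matchEdge v) = inj₁ v

  end₂ : E12 n m → V12 n
  end₂ (arcEdge e)   = inj₁ (head e)
  end₂ (matchEdge v) = inj₂ v

  c12 : E12 n m → ℚ
  c12 (arcEdge e)   = ℤ→ℚ (c e)
  c12 (matchEdge v) = 0ℚ

  IsPacking : (V12 n → ℚ) → Set
  IsPacking y = (f : E12 n m) → y (end₁ f) + y (end₂ f) ≤ c12 f

sumFin : {k : ℕ} → (Fin k → ℚ) → ℚ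
sumFin {zero}  f = 0ℚ
sumFin {suc k} f = f zero + sumFin (λ i → f (suc i))

weight : {n : ℕ} → (V12 n → ℚ) → ℚ
weight y = sumFin (λ v → y (inj₁ v)) + sumFin (λ v → y (inj₂ v))

module _ {n m : ℕ} (G : Digraph n m) (c : Fin m → ℤ) where
  IsMaxPacking : (V12 n → ℚ) → Set
  IsMaxPacking y = IsPacking G c y × ((y' : V12 n → ℚ) → IsPacking G c y' → weight y' ≤ weight y)
    where open import Data.Product using (_×_)

  IsPotential : (Fin n → ℚ) → Set
  IsPotential p = (e : Fin m) → 0ℚ ≤ ℤ→ℚ (c e) + p (Digraph.tail G e) - p (Digraph.head G e)
    where open Data.Rational using (_-_)

-- Every matching edge v₁v₂ has weight 0, so the packing condition gives
-- y(v₁) + y(v₂) ≤ 0 for each v, while these n terms add up to y(V₁ ∪ V₂) = 0;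
-- hence each of them is exactly 0 (we only need ≥ 0).  For an arc uv the arc edge
-- u₂v₁ gives y(u₂) ≤ c_uv − y(v₁), and therefore
-- 0 ≤ y(u₁) + y(u₂) ≤ c_uv + y(u₁) − y(v₁).
module Submission where

open import Defs
open import Data.Nat using (ℕ; zero; suc)
open import Data.Fin using (Fin; zero; suc)
open import Data.Integer using (ℤ)
open import Data.Sum using (inj₁; inj₂)
open import Data.Product using (_,_)
open import Data.Rational using (ℚ; 0ℚ; _+_; _-_; _≤_)
open import Data.Rational.Properties
open import Algebra.Bundles using (CommutativeMonoid)
open import Relation.Binary.PropositionalEquality using (_≡_; sym; trans; cong; module ≡-Reasoning)
import Algebra.Properties.CommutativeSemigroup as CommSemigroupProperties
import Algebra.Properties.Group as GroupProperties

open CommSemigroupProperties (CommutativeMonoid.commutativeSemigroup +-0-commutativeMonoid)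
  using (interchange; x∙yz≈yx∙z)
open GroupProperties +-0-group using (//-rightDividesʳ)

sumFin-+ : ∀ {k} (f g : Fin k → ℚ) → sumFin f + sumFin g ≡ sumFin (λ i → f i + g i)
sumFin-+ {zero}  f g = +-identityʳ 0ℚ
sumFin-+ {suc k} f g = begin
  (f zero + sumFin (λ i → f (suc i))) + (g zero + sumFin (λ i → g (suc i)))
    ≡⟨ interchange (f zero) _ (g zero) _ ⟩
  (f zero + g zero) + (sumFin (λ i → f (suc i)) + sumFin (λ i → g (suc i)))
    ≡⟨ cong (f zero + g zero +_) (sumFin-+ (λ i → f (suc i)) (λ i → g (suc i))) ⟩
  (f zero + g zero) + sumFin (λ i → f (suc i) + g (suc i)) ∎
  where open ≡-Reasoning

sumFin-nonpos : ∀ {k} (f : Fin k → ℚ) → (∀ i → f i ≤ 0ℚ) → sumFin f ≤ 0ℚ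
sumFin-nonpos {zero}  f f≤0 = ≤-refl
sumFin-nonpos {suc k} f f≤0 = +-mono-≤ (f≤0 zero) (sumFin-nonpos _ (λ i → f≤0 (suc i)))

sumFin-nonpos-nonneg⇒nonneg : ∀ {k} (f : Fin k → ℚ) → (∀ i → f i ≤ 0ℚ) →
  0ℚ ≤ sumFin f → ∀ i → 0ℚ ≤ f i
sumFin-nonpos-nonneg⇒nonneg {suc k} f f≤0 0≤Σ zero = begin
  0ℚ                                ≤⟨ 0≤Σ ⟩
  f zero + sumFin (λ i → f (suc i)) ≤⟨ +-monoʳ-≤ (f zero) (sumFin-nonpos _ (λ i → f≤0 (suc i))) ⟩
  f zero + 0ℚ                       ≡⟨ +-identityʳ (f zero) ⟩
  f zero                            ∎
  where open ≤-Reasoning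
sumFin-nonpos-nonneg⇒nonneg {suc k} f f≤0 0≤Σ (suc i) =
  sumFin-nonpos-nonneg⇒nonneg (λ j → f (suc j)) (λ j → f≤0 (suc j)) 0≤Σtail i
  where
  open ≤-Reasoning
  0≤Σtail : 0ℚ ≤ sumFin (λ j → f (suc j))
  0≤Σtail = begin
    0ℚ                                ≤⟨ 0≤Σ ⟩
    f zero + sumFin (λ j → f (suc j)) ≤⟨ +-monoˡ-≤ _ (f≤0 zero) ⟩
    0ℚ + sumFin (λ j → f (suc j))     ≡⟨ +-identityˡ _ ⟩
    sumFin (λ j → f (suc j))          ∎

0≤a+b∧b+d≤c⇒0≤c+a-d : ∀ {a b c d : ℚ} → 0ℚ ≤ a + b → b + d ≤ c → 0ℚ ≤ c + a - d
0≤a+b∧b+d≤c⇒0≤c+a-d {a} {b} {c} {d} 0≤a+b b+d≤c = begin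
  0ℚ              ≤⟨ 0≤a+b ⟩
  a + b           ≡⟨ cong (a +_) (//-rightDividesʳ d b) ⟨
  a + (b + d - d) ≤⟨ +-monoʳ-≤ a (+-monoˡ-≤ _ b+d≤c) ⟩
  a + (c - d)     ≡⟨ x∙yz≈yx∙z a c _ ⟩
  c + a - d       ∎
  where open ≤-Reasoning

weight≡sumFin-pairs : ∀ {n} (y : V12 n → ℚ) →
  weight y ≡ sumFin (λ v → y (inj₁ v) + y (inj₂ v))
weight≡sumFin-pairs y = sumFin-+ (λ v → y (inj₁ v)) (λ v → y (inj₂ v))

packing-weight≡0⇒pair-nonneg : ∀ {n m} (G : Digraph n m) (c : Fin m → ℤ) (y : V12 n → ℚ) →
  IsPacking G c y → weight y ≡ 0ℚ → ∀ v → 0ℚ ≤ y (inj₁ v) + y (inj₂ v)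
packing-weight≡0⇒pair-nonneg G c y packing w≡0 =
  sumFin-nonpos-nonneg⇒nonneg _ (λ v → packing (matchEdge v))
    (≤-reflexive (trans (sym w≡0) (weight≡sumFin-pairs y)))

mainTheorem13 : {n m : ℕ} (G : Digraph n m) (c : Fin m → ℤ) (y : V12 n → ℚ) →
    IsMaxPacking G c y → weight y ≡ 0ℚ →
    IsPotential G c (λ v → y (inj₁ v))
mainTheorem13 G c y (packing , _) w≡0 e =
  0≤a+b∧b+d≤c⇒0≤c+a-d
    (packing-weight≡0⇒pair-nonneg G c y packing w≡0 (Digraph.tail G e))
    (packing (arcEdge e))
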